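{- Let $\mathcal{C}$ and $\mathcal{D}$ be gs-monoidal categories and $F:\mathcal{C}\to\mathcal{D}$ a lax symmetric monoidal functor which is either affine or relevant. Then $F$ is mass preserving.
   Context: Composition is diagrammatic ($f;g$ means first $f$, then $g$); the right unitor is $\rho_X:X\to X\otimes I$. A gs-monoidal category is a symmetric monoidal category with, for each object $X$, a discharger $!_X:X\to I$ and duplicator $\nabla_X:X\to X\otimes X$, compatible with the monoidal structure, with $\nabla_X$ coassociative, cocommutative, and $(X,\nabla_X,!_X)$ a comonoid. $F$ has structure arrows $\psi_{X,Y}:F(X)\otimes F(Y)\to F(X\otimes Y)$, $\psi_0:I\to F(I)$. $F$ is affine if $F(!_X)=!_{F(X)};\psi_0$ for all $X$; relevant if $F(\nabla_X)=\nabla_{F(X)};\psi_{X,X}$ for all $X$; mass preserving if $\nabla_{F(X)};\psi_{X,X};F(!_X\otimes !_X)=F(!_X);F(\rho_I)$ for all $X$. -}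

module Defs where

-- Conventions: composition is diagrammatic, f ⨾ g = "first f, then g".

open import Level using (Level; _⊔_) renaming (suc to lsuc)
open import Relation.Binary using (Rel; IsEquivalence)

record Category (o ℓ e : Level) : Set (lsuc (o ⊔ ℓ ⊔ e)) where
  infix  4 _≈_
  infixr 9 _⨾_
  field
    Obj   : Set o
    _⇒_   : Obj → Obj → Set ℓ
    _≈_   : ∀ {A B} → Rel (A ⇒ B) e
    id    : ∀ {A} → A ⇒ A
    _⨾_   : ∀ {A B C} → A ⇒ B → B ⇒ C → A ⇒ C
    ≈-equiv   : ∀ {A B} → IsEquivalence (_≈_ {A} {B})
    assoc     : ∀ {A B C D} {f : A ⇒ B} {g : B ⇒ C} {h : C ⇒ D} →
                (f ⨾ g) ⨾ h ≈ f ⨾ (g ⨾ h)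
    identityˡ : ∀ {A B} {f : A ⇒ B} → id ⨾ f ≈ f
    identityʳ : ∀ {A B} {f : A ⇒ B} → f ⨾ id ≈ f
    ⨾-resp-≈  : ∀ {A B C} {f f' : A ⇒ B} {g g' : B ⇒ C} →
                f ≈ f' → g ≈ g' → f ⨾ g ≈ f' ⨾ g'

record SymmetricMonoidal {o ℓ e : Level} (C : Category o ℓ e) : Set (o ⊔ ℓ ⊔ e) where
  open Category C
  infixr 10 _⊗₀_ _⊗₁_
  field
    _⊗₀_ : Obj → Obj → Obj
    _⊗₁_ : ∀ {A B C D} → A ⇒ B → C ⇒ D → (A ⊗₀ C) ⇒ (B ⊗₀ D)
    I    : Obj
    ⊗-identity : ∀ {A B} → id {A} ⊗₁ id {B} ≈ id
    ⊗-homo     : ∀ {A B C D E F} {f : A ⇒ B} {g : B ⇒ C} {h : D ⇒ E} {k : E ⇒ F} →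
                 (f ⨾ g) ⊗₁ (h ⨾ k) ≈ (f ⊗₁ h) ⨾ (g ⊗₁ k)
    ⊗-resp-≈   : ∀ {A B C D} {f f' : A ⇒ B} {g g' : C ⇒ D} →
                 f ≈ f' → g ≈ g' → f ⊗₁ g ≈ f' ⊗₁ g'

    λ⇒ : ∀ X → X ⇒ (I ⊗₀ X)
    λ⇐ : ∀ X → (I ⊗₀ X) ⇒ X
    ρ⇒ : ∀ X → X ⇒ (X ⊗₀ I)
    ρ⇐ : ∀ X → (X ⊗₀ I) ⇒ X
    α⇒ : ∀ X Y Z → ((X ⊗₀ Y) ⊗₀ Z) ⇒ (X ⊗₀ (Y ⊗₀ Z))
    α⇐ : ∀ X Y Z → (X ⊗₀ (Y ⊗₀ Z)) ⇒ ((X ⊗₀ Y) ⊗₀ Z)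
    σ  : ∀ X Y → (X ⊗₀ Y) ⇒ (Y ⊗₀ X)

    λ-isoˡ : ∀ {X} → λ⇒ X ⨾ λ⇐ X ≈ id
    λ-isoʳ : ∀ {X} → λ⇐ X ⨾ λ⇒ X ≈ id
    ρ-isoˡ : ∀ {X} → ρ⇒ X ⨾ ρ⇐ X ≈ id
    ρ-isoʳ : ∀ {X} → ρ⇐ X ⨾ ρ⇒ X ≈ id
    α-isoˡ : ∀ {X Y Z} → α⇒ X Y Z ⨾ α⇐ X Y Z ≈ id
    α-isoʳ : ∀ {X Y Z} → α⇐ X Y Z ⨾ α⇒ X Y Z ≈ id
    σ-invol : ∀ {X Y} → σ X Y ⨾ σ Y X ≈ id

    λ-natural : ∀ {A B} {f : A ⇒ B} → f ⨾ λ⇒ B ≈ λ⇒ A ⨾ (id ⊗₁ f)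
    ρ-natural : ∀ {A B} {f : A ⇒ B} → f ⨾ ρ⇒ B ≈ ρ⇒ A ⨾ (f ⊗₁ id)
    α-natural : ∀ {A B C D E F} {f : A ⇒ B} {g : C ⇒ D} {h : E ⇒ F} →
                ((f ⊗₁ g) ⊗₁ h) ⨾ α⇒ B D F ≈ α⇒ A C E ⨾ (f ⊗₁ (g ⊗₁ h))
    σ-natural : ∀ {A B C D} {f : A ⇒ B} {g : C ⇒ D} →
                (f ⊗₁ g) ⨾ σ B D ≈ σ A C ⨾ (g ⊗₁ f)

    triangle : ∀ {X Y} → (ρ⇒ X ⊗₁ id {Y}) ⨾ α⇒ X I Y ≈ id {X} ⊗₁ λ⇒ Y
    pentagon : ∀ {W X Y Z} →
               α⇒ (W ⊗₀ X) Y Z ⨾ α⇒ W X (Y ⊗₀ Z)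
                 ≈ (α⇒ W X Y ⊗₁ id {Z}) ⨾ (α⇒ W (X ⊗₀ Y) Z ⨾ (id {W} ⊗₁ α⇒ X Y Z))
    hexagon  : ∀ {X Y Z} →
               α⇒ X Y Z ⨾ (σ X (Y ⊗₀ Z) ⨾ α⇒ Y Z X)
                 ≈ (σ X Y ⊗₁ id {Z}) ⨾ (α⇒ Y X Z ⨾ (id {Y} ⊗₁ σ X Z))

  τ : ∀ X X' Y Y' → ((X ⊗₀ X') ⊗₀ (Y ⊗₀ Y')) ⇒ ((X ⊗₀ Y) ⊗₀ (X' ⊗₀ Y'))
  τ X X' Y Y' =
    α⇒ X X' (Y ⊗₀ Y')
    ⨾ ((id {X} ⊗₁ (α⇐ X' Y Y' ⨾ ((σ X' Y ⊗₁ id {Y'}) ⨾ α⇒ Y X' Y')))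
    ⨾ α⇐ X Y (X' ⊗₀ Y'))

record GSMonoidal (o ℓ e : Level) : Set (lsuc (o ⊔ ℓ ⊔ e)) where
  field
    cat : Category o ℓ e
    sym : SymmetricMonoidal cat
  open Category cat public
  open SymmetricMonoidal sym public
  field
    ! : ∀ X → X ⇒ I
    ∇ : ∀ X → X ⇒ (X ⊗₀ X)
    !-unit   : ! I ≈ id
    ∇-unit   : ∇ I ≈ ρ⇒ I
    !-tensor : ∀ {X Y} → ! (X ⊗₀ Y) ≈ (! X ⊗₁ ! Y) ⨾ λ⇐ I
    ∇-tensor : ∀ {X Y} → ∇ (X ⊗₀ Y) ≈ (∇ X ⊗₁ ∇ Y) ⨾ τ X X Y Y
    ∇-coassoc : ∀ {X} → ∇ X ⨾ ((∇ X ⊗₁ id) ⨾ α⇒ X X X) ≈ ∇ X ⨾ (id ⊗₁ ∇ X)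
    ∇-cocomm  : ∀ {X} → ∇ X ⨾ σ X X ≈ ∇ X
    counitˡ   : ∀ {X} → ∇ X ⨾ (! X ⊗₁ id) ≈ λ⇒ X
    counitʳ   : ∀ {X} → ∇ X ⨾ (id ⊗₁ ! X) ≈ ρ⇒ X

record LaxSymMonoidalFunctor {o ℓ e o' ℓ' e' : Level}
         (C : GSMonoidal o ℓ e) (D : GSMonoidal o' ℓ' e')
         : Set (o ⊔ ℓ ⊔ e ⊔ o' ⊔ ℓ' ⊔ e') where
  private
    module C = GSMonoidal C
    module D = GSMonoidal D
  field
    F₀ : C.Obj → D.Obj
    F₁ : ∀ {A B} → A C.⇒ B → F₀ A D.⇒ F₀ B
    F-identity : ∀ {A} → F₁ (C.id {A}) D.≈ D.id
    F-homo     : ∀ {A B E} {f : A C.⇒ B} {g : B C.⇒ E} →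
                 F₁ (f C.⨾ g) D.≈ F₁ f D.⨾ F₁ g
    F-resp-≈   : ∀ {A B} {f g : A C.⇒ B} → f C.≈ g → F₁ f D.≈ F₁ g

    ψ  : ∀ X Y → (F₀ X D.⊗₀ F₀ Y) D.⇒ F₀ (X C.⊗₀ Y)
    ψ₀ : D.I D.⇒ F₀ C.I

    ψ-natural : ∀ {A B A' B'} {f : A C.⇒ B} {g : A' C.⇒ B'} →
                (F₁ f D.⊗₁ F₁ g) D.⨾ ψ B B' D.≈ ψ A A' D.⨾ F₁ (f C.⊗₁ g)
    ψ-assoc   : ∀ {X Y Z} →
                (ψ X Y D.⊗₁ D.id) D.⨾ (ψ (X C.⊗₀ Y) Z D.⨾ F₁ (C.α⇒ X Y Z))
                  D.≈ D.α⇒ (F₀ X) (F₀ Y) (F₀ Z) D.⨾ ((D.id D.⊗₁ ψ Y Z) D.⨾ ψ X (Y C.⊗₀ Z))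
    ψ-unitˡ   : ∀ {X} →
                D.λ⇒ (F₀ X) D.⨾ ((ψ₀ D.⊗₁ D.id) D.⨾ ψ C.I X) D.≈ F₁ (C.λ⇒ X)
    ψ-unitʳ   : ∀ {X} →
                D.ρ⇒ (F₀ X) D.⨾ ((D.id D.⊗₁ ψ₀) D.⨾ ψ X C.I) D.≈ F₁ (C.ρ⇒ X)
    ψ-symmetric : ∀ {X Y} →
                D.σ (F₀ X) (F₀ Y) D.⨾ ψ Y X D.≈ ψ X Y D.⨾ F₁ (C.σ X Y)

module _ {o ℓ e o' ℓ' e' : Level} {C : GSMonoidal o ℓ e} {D : GSMonoidal o' ℓ' e'} where
  private
    module C = GSMonoidal C
    module D = GSMonoidal D

  Affine : LaxSymMonoidalFunctor C D → Set (o ⊔ e')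
  Affine F = ∀ X → F₁ (C.! X) D.≈ D.! (F₀ X) D.⨾ ψ₀
    where open LaxSymMonoidalFunctor F

  Relevant : LaxSymMonoidalFunctor C D → Set (o ⊔ e')
  Relevant F = ∀ X → F₁ (C.∇ X) D.≈ D.∇ (F₀ X) D.⨾ ψ X X
    where open LaxSymMonoidalFunctor F

  MassPreserving : LaxSymMonoidalFunctor C D → Set (o ⊔ e')
  MassPreserving F =
    ∀ X → D.∇ (F₀ X) D.⨾ (ψ X X D.⨾ F₁ (C.! X C.⊗₁ C.! X))
            D.≈ F₁ (C.! X) D.⨾ F₁ (C.ρ⇒ C.I)
    where open LaxSymMonoidalFunctor F

{-# OPTIONS --safe #-}
module Submission where

-- Both cases rest on the identity ∇ ⨾ (! ⊗ !) ≈ ! ⨾ ρ, a consequence of the counit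
-- law.  A relevant F transports it from C by functoriality.  For an affine F,
-- naturality of ψ turns F ! ⊗ F ! into (! ⊗ !) ⨾ (ψ₀ ⊗ ψ₀) in D, the identity
-- applies there, and the right unit law of ψ absorbs the two copies of ψ₀.

open import Defs
open import Level using (Level)
open import Data.Sum using (_⊎_; [_,_]′)
open import Relation.Binary using (Setoid)
import Relation.Binary.Reasoning.Setoid as SetoidReasoning

module CategoryProperties {o ℓ e} (C : Category o ℓ e) where
  open Category C

  hom-setoid : ∀ A B → Setoid ℓ e
  hom-setoid A B = record { Carrier = A ⇒ B ; _≈_ = _≈_ ; isEquivalence = ≈-equiv }

  module HomReasoning {A B : Obj} where
    open Setoid (hom-setoid A B) public using (refl; sym; trans)
    open SetoidReasoning (hom-setoid A B) public

  open HomReasoning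

  ⨾-resp-≈ˡ : ∀ {A B E} {f f' : A ⇒ B} {g : B ⇒ E} → f ≈ f' → f ⨾ g ≈ f' ⨾ g
  ⨾-resp-≈ˡ p = ⨾-resp-≈ p refl

  ⨾-resp-≈ʳ : ∀ {A B E} {f : A ⇒ B} {g g' : B ⇒ E} → g ≈ g' → f ⨾ g ≈ f ⨾ g'
  ⨾-resp-≈ʳ p = ⨾-resp-≈ refl p

  assoc-middle : ∀ {A B E G H} {f : A ⇒ B} {g : B ⇒ E} {h : E ⇒ G} {k : G ⇒ H} →
                 f ⨾ ((g ⨾ h) ⨾ k) ≈ (f ⨾ g) ⨾ (h ⨾ k)
  assoc-middle = trans (⨾-resp-≈ʳ assoc) (sym assoc)

module MonoidalProperties {o ℓ e} {C : Category o ℓ e} (M : SymmetricMonoidal C) where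
  open Category C
  open SymmetricMonoidal M
  open CategoryProperties C
  open HomReasoning

  serialize₁₂ : ∀ {A B E G} {f : A ⇒ B} {g : E ⇒ G} → f ⊗₁ g ≈ (f ⊗₁ id) ⨾ (id ⊗₁ g)
  serialize₁₂ = trans (⊗-resp-≈ (sym identityʳ) (sym identityˡ)) ⊗-homo

  serialize₂₁ : ∀ {A B E G} {f : A ⇒ B} {g : E ⇒ G} → f ⊗₁ g ≈ (id ⊗₁ g) ⨾ (f ⊗₁ id)
  serialize₂₁ = trans (⊗-resp-≈ (sym identityˡ) (sym identityʳ)) ⊗-homo

module GSMonoidalProperties {o ℓ e} (G : GSMonoidal o ℓ e) where
  open GSMonoidal G hiding (sym)
  open CategoryProperties cat
  open MonoidalProperties (GSMonoidal.sym G)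
  open HomReasoning

  ∇⨾!⊗!≈!⨾ρ : ∀ X → ∇ X ⨾ (! X ⊗₁ ! X) ≈ ! X ⨾ ρ⇒ I
  ∇⨾!⊗!≈!⨾ρ X = begin
    ∇ X ⨾ (! X ⊗₁ ! X)                 ≈⟨ ⨾-resp-≈ʳ serialize₂₁ ⟩
    ∇ X ⨾ ((id ⊗₁ ! X) ⨾ (! X ⊗₁ id))  ≈⟨ sym assoc ⟩
    (∇ X ⨾ (id ⊗₁ ! X)) ⨾ (! X ⊗₁ id)  ≈⟨ ⨾-resp-≈ˡ counitʳ ⟩
    ρ⇒ X ⨾ (! X ⊗₁ id)                 ≈⟨ sym ρ-natural ⟩
    ! X ⨾ ρ⇒ I                         ∎

module LaxFunctorProperties {o ℓ e o' ℓ' e'} {C : GSMonoidal o ℓ e} {D : GSMonoidal o' ℓ' e'}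
         (F : LaxSymMonoidalFunctor C D) where
  private module C = GSMonoidal C
  open GSMonoidal D hiding (sym)
  open LaxSymMonoidalFunctor F
  open CategoryProperties cat
  open MonoidalProperties (GSMonoidal.sym D)
  open GSMonoidalProperties D
  open HomReasoning

  ρ⨾ψ₀-unitʳ : ∀ {A X} (f : A ⇒ F₀ X) →
               ρ⇒ A ⨾ ((f ⊗₁ ψ₀) ⨾ ψ X C.I) ≈ f ⨾ F₁ (C.ρ⇒ X)
  ρ⨾ψ₀-unitʳ {A} {X} f = begin
    ρ⇒ A ⨾ ((f ⊗₁ ψ₀) ⨾ ψ X C.I)                ≈⟨ ⨾-resp-≈ʳ (⨾-resp-≈ˡ serialize₁₂) ⟩
    ρ⇒ A ⨾ (((f ⊗₁ id) ⨾ (id ⊗₁ ψ₀)) ⨾ ψ X C.I) ≈⟨ assoc-middle ⟩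
    (ρ⇒ A ⨾ (f ⊗₁ id)) ⨾ ((id ⊗₁ ψ₀) ⨾ ψ X C.I) ≈⟨ ⨾-resp-≈ˡ (sym ρ-natural) ⟩
    (f ⨾ ρ⇒ (F₀ X)) ⨾ ((id ⊗₁ ψ₀) ⨾ ψ X C.I)    ≈⟨ assoc ⟩
    f ⨾ (ρ⇒ (F₀ X) ⨾ ((id ⊗₁ ψ₀) ⨾ ψ X C.I))    ≈⟨ ⨾-resp-≈ʳ ψ-unitʳ ⟩
    f ⨾ F₁ (C.ρ⇒ X)                              ∎

  relevant⇒mass-preserving : Relevant F → MassPreserving F
  relevant⇒mass-preserving relevant X = begin
    ∇ (F₀ X) ⨾ (ψ X X ⨾ F₁ (C.! X C.⊗₁ C.! X))  ≈⟨ sym assoc ⟩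
    (∇ (F₀ X) ⨾ ψ X X) ⨾ F₁ (C.! X C.⊗₁ C.! X)  ≈⟨ ⨾-resp-≈ˡ (sym (relevant X)) ⟩
    F₁ (C.∇ X) ⨾ F₁ (C.! X C.⊗₁ C.! X)          ≈⟨ sym F-homo ⟩
    F₁ (C.∇ X C.⨾ (C.! X C.⊗₁ C.! X))           ≈⟨ F-resp-≈ (GSMonoidalProperties.∇⨾!⊗!≈!⨾ρ C X) ⟩
    F₁ (C.! X C.⨾ C.ρ⇒ C.I)                     ≈⟨ F-homo ⟩
    F₁ (C.! X) ⨾ F₁ (C.ρ⇒ C.I)                  ∎

  affine⇒mass-preserving : Affine F → MassPreserving F
  affine⇒mass-preserving affine X = begin
    ∇ A ⨾ (ψ X X ⨾ F₁ (C.! X C.⊗₁ C.! X))              ≈⟨ ⨾-resp-≈ʳ (sym ψ-natural) ⟩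
    ∇ A ⨾ ((F₁ (C.! X) ⊗₁ F₁ (C.! X)) ⨾ ψ C.I C.I)      ≈⟨ ⨾-resp-≈ʳ (⨾-resp-≈ˡ F!⊗F!≈!⊗!⨾ψ₀⊗ψ₀) ⟩
    ∇ A ⨾ (((! A ⊗₁ ! A) ⨾ (ψ₀ ⊗₁ ψ₀)) ⨾ ψ C.I C.I)    ≈⟨ assoc-middle ⟩
    (∇ A ⨾ (! A ⊗₁ ! A)) ⨾ ((ψ₀ ⊗₁ ψ₀) ⨾ ψ C.I C.I)    ≈⟨ ⨾-resp-≈ˡ (∇⨾!⊗!≈!⨾ρ A) ⟩
    (! A ⨾ ρ⇒ I) ⨾ ((ψ₀ ⊗₁ ψ₀) ⨾ ψ C.I C.I)            ≈⟨ assoc ⟩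
    ! A ⨾ (ρ⇒ I ⨾ ((ψ₀ ⊗₁ ψ₀) ⨾ ψ C.I C.I))            ≈⟨ ⨾-resp-≈ʳ (ρ⨾ψ₀-unitʳ ψ₀) ⟩
    ! A ⨾ (ψ₀ ⨾ F₁ (C.ρ⇒ C.I))                        ≈⟨ sym assoc ⟩
    (! A ⨾ ψ₀) ⨾ F₁ (C.ρ⇒ C.I)                        ≈⟨ ⨾-resp-≈ˡ (sym (affine X)) ⟩
    F₁ (C.! X) ⨾ F₁ (C.ρ⇒ C.I)                        ∎
    where
    A = F₀ X
    F!⊗F!≈!⊗!⨾ψ₀⊗ψ₀ : F₁ (C.! X) ⊗₁ F₁ (C.! X) ≈ (! A ⊗₁ ! A) ⨾ (ψ₀ ⊗₁ ψ₀)
    F!⊗F!≈!⊗!⨾ψ₀⊗ψ₀ = trans (⊗-resp-≈ (affine X) (affine X)) ⊗-homo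

corollary4p7 : ∀ {o ℓ e o' ℓ' e' : Level}
    (C : GSMonoidal o ℓ e) (D : GSMonoidal o' ℓ' e')
    (F : LaxSymMonoidalFunctor C D) →
    Affine F ⊎ Relevant F → MassPreserving F
corollary4p7 C D F = [ affine⇒mass-preserving , relevant⇒mass-preserving ]′
  where open LaxFunctorProperties F
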